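{- Let $r\geq 2$ be an integer. If $G$ is a $(5,5r)$-biregular bipartite graph, then $r+1\leq \check s(G)\leq r^3+1$.
   Context: A graph is $(a,b)$-biregular if it is bipartite with a bipartition $(X,Y)$ such that every vertex of $X$ has degree $a$ and every vertex of $Y$ has degree $b$. For a proper edge coloring $\varphi$ of a graph $G$, the palette of a vertex $v$ is the set of colors on edges incident with $v$. The palette index $\check s(G)$ is the minimum number of distinct palettes over all proper edge colorings of $G$. -}

module Defs where

open import Data.Nat using (ℕ; _+_; _*_; _^_; _≤_; suc)
open import Data.Bool using (Bool; true; false; T; not)
open import Data.Fin using (Fin)
open import Data.List using (List; length; filterᵇ; allFin)
open import Data.Product using (Σ; ∃; _×_; _,_)
open import Relation.Binary.PropositionalEquality using (_≡_; _≢_)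
open import Relation.Nullary using (¬_)
open import Function.Bundles using (_⇔_)

record Graph (n : ℕ) : Set where
  field
    adj     : Fin n → Fin n → Bool
    symm    : ∀ u v → adj u v ≡ adj v u
    irrefl  : ∀ v → adj v v ≡ false
open Graph public

deg : ∀ {n} → Graph n → Fin n → ℕ
deg {n} G v = length (filterᵇ (adj G v) (allFin n))

IsBiregular : ∀ {n} → ℕ → ℕ → Graph n → Set
IsBiregular {n} a b G =
  Σ (Fin n → Bool) λ side →
    (∀ u v → T (adj G u v) → side u ≢ side v) ×
    (∀ v → side v ≡ true → deg G v ≡ a) ×
    (∀ v → side v ≡ false → deg G v ≡ b)

-- An edge colouring with colours in ℕ: φ u v is the colour of edge uv
-- (only meaningful when u,v adjacent); it must not depend on the
-- orientation of the edge.
record ProperEdgeColouring {n} (G : Graph n) : Set where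
  field
    col     : Fin n → Fin n → ℕ
    col-sym : ∀ u v → T (adj G u v) → col u v ≡ col v u
    proper  : ∀ v u w → T (adj G v u) → T (adj G v w) → u ≢ w → col v u ≢ col v w
open ProperEdgeColouring public

InPalette : ∀ {n} {G : Graph n} → ProperEdgeColouring G → Fin n → ℕ → Set
InPalette {G = G} φ v c = ∃ λ u → T (adj G v u) × col φ v u ≡ c

SamePalette : ∀ {n} {G : Graph n} → ProperEdgeColouring G → Fin n → Fin n → Set
SamePalette φ v w = ∀ c → InPalette φ v c ⇔ InPalette φ w c

AtMostPalettes : ∀ {n} {G : Graph n} → ProperEdgeColouring G → ℕ → Set
AtMostPalettes {n} φ k =
  Σ (Fin n → Fin k) λ f → ∀ v w → f v ≡ f w → SamePalette φ v w

PaletteIndex≤ : ∀ {n} → Graph n → ℕ → Set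
PaletteIndex≤ G k = Σ (ProperEdgeColouring G) λ φ → AtMostPalettes φ k

PaletteIndex≥ : ∀ {n} → Graph n → ℕ → Set
PaletteIndex≥ G k = ∀ j → PaletteIndex≤ G j → k ≤ j

module Submission where

-- A Y-vertex y has degree 5r and its
-- neighbours degree 5, so no neighbour shares the palette of y; and each other
-- palette contains at most 5 of the 5r colours at y. Hence at least r palettes
-- besides that of y occur.
--
-- König's edge colouring theorem for bipartite
-- multigraphs (module König, proved by Kempe swaps) is applied three times:
-- (1) G gets 5r colours, grouped into r blocks of 5; (2) the edges get classes
-- 0,…,4 such that every X-vertex meets each class once and each Y-vertex meets
-- each class once per block; (3) for the class pairs {0,1}, {2,3}, {4} the
-- X-vertices get colours K below r, distinct for two X-vertices with a common
-- neighbour along edges of a class of the pair. Colouring an edge xy of class i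
-- by i + 5 · K i x, every Y-vertex sees all 5r colours, and the palette of an
-- X-vertex x only depends on the three values of K at x: r³ + 1 palettes.

open import Defs
open import Data.Nat using (ℕ; _+_; _*_; _^_; _≤_; suc)
open import Data.Fin using (Fin)
open import Data.Product using (_×_; _,_)

open import Data.Nat using (zero; _<_; z≤n; s≤s; NonZero; >-nonZero; _/_; _%_)
import Data.Nat.Properties as ℕ
open import Data.Nat.DivMod using (_mod_; [m+kn]%n≡m%n; m<n⇒m%n≡m; m≡m%n+[m/n]*n; m%n<n; m<n*o⇒m/o<n)
open import Data.Bool using (Bool; true; false; T; if_then_else_)
import Data.Bool as Bool
open import Data.Bool.Properties using (T?)
open import Data.Fin using (toℕ; fromℕ<; punchOut; combine; remQuot; inject≤)
  renaming (zero to fzero; suc to fsuc)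
open import Data.Fin.Properties
  using (any?; all?; ¬∀⟶∃¬; toℕ-injective; toℕ-fromℕ<; toℕ-inject≤; toℕ<n; suc-injective; injective⇒≤;
         punchOut-injective; combine-injective; remQuot-combine; combine-remQuot)
  renaming (_≟_ to _≟F_)
open import Data.List using (List; _∷_; lookup; filterᵇ; allFin)
import Data.List.Relation.Unary.Any as Any
open import Data.List.Relation.Unary.All using () renaming (lookup to lookupAll)
open import Data.List.Relation.Unary.AllPairs using (_∷_)
open import Data.List.Relation.Unary.Unique.Propositional using (Unique)
open import Data.List.Relation.Unary.Unique.Propositional.Properties using (filter⁺; allFin⁺)
open import Data.List.Membership.Propositional.Properties using (∈-lookup; ∈-filter⁺; ∈-filter⁻; ∈-allFin)
open import Data.List.Membership.Setoid.Properties using (index-injective)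
open import Data.Maybe using (Maybe; just; nothing; _>>=_)
open import Data.Maybe.Properties using (≡-dec)
open import Data.Product using (Σ; ∃; proj₁; proj₂)
open import Data.Product.Properties using () renaming (≡-dec to ×-≡-dec)
open import Data.Sum using (_⊎_; inj₁; inj₂)
open import Data.Empty using (⊥-elim)
open import Relation.Nullary using (yes; no; ¬_)
open import Relation.Nullary.Decidable using (_×-dec_)
open import Relation.Unary using (Decidable)
open import Relation.Binary.Definitions using (DecidableEquality)
open import Relation.Binary.PropositionalEquality
  using (_≡_; _≢_; refl; sym; trans; cong; cong₂; subst; subst₂; setoid; module ≡-Reasoning)
open import Function using (_∘_)
open import Function.Bundles using (Equivalence; mk⇔)

witness : ∀ {N} {P : Fin N → Set} → Decidable P → Fin N → Fin N
witness P? d with any? P?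
... | yes (x , _) = x
... | no _        = d

witness-holds : ∀ {N} {P : Fin N → Set} (P? : Decidable P) d → ∃ P → P (witness P? d)
witness-holds P? d ex with any? P?
... | yes (_ , p) = p
... | no ¬ex      = ⊥-elim (¬ex ex)

witness-default : ∀ {N} {P : Fin N → Set} (P? : Decidable P) d d' → ∃ P → witness P? d ≡ witness P? d'
witness-default P? d d' ex with any? P?
... | yes _  = refl
... | no ¬ex = ⊥-elim (¬ex ex)

injective⇒surjective : ∀ {N} (h : Fin N → Fin N) → (∀ {s t} → h s ≡ h t → s ≡ t) → ∀ t → ∃ λ s → h s ≡ t
injective⇒surjective {suc N} h h-inj t with any? (λ s → h s ≟F t)
... | yes hit = hit
... | no miss = ⊥-elim (ℕ.<-irrefl refl (injective⇒≤ avoid-injective))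
  where
  -- h misses t, so it factors injectively through Fin N
  avoid : Fin (suc N) → Fin N
  avoid s = punchOut {i = t} (λ t≡hs → miss (s , sym t≡hs))
  avoid-injective : ∀ {s s'} → avoid s ≡ avoid s' → s ≡ s'
  avoid-injective {s} {s'} eq = h-inj (punchOut-injective {i = t} (λ t≡hs → miss (s , sym t≡hs)) (λ t≡hs → miss (s' , sym t≡hs)) eq)

lookup-injective : ∀ {A : Set} {xs : List A} → Unique xs → ∀ {i j} → lookup xs i ≡ lookup xs j → i ≡ j
lookup-injective {xs = x ∷ xs} (x∉xs ∷ u) {fzero}  {fzero}  eq = refl
lookup-injective {xs = x ∷ xs} (x∉xs ∷ u) {fzero}  {fsuc j} eq = ⊥-elim (lookupAll x∉xs (∈-lookup j) eq)
lookup-injective {xs = x ∷ xs} (x∉xs ∷ u) {fsuc i} {fzero}  eq = ⊥-elim (lookupAll x∉xs (∈-lookup i) (sym eq))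
lookup-injective {xs = x ∷ xs} (x∉xs ∷ u) {fsuc i} {fsuc j} eq = cong fsuc (lookup-injective u eq)

digits-injective : ∀ {q a a' b b'} → a < q → a' < q → a + q * b ≡ a' + q * b' → a ≡ a' × b ≡ b'
digits-injective {suc q} {a} {a'} {b} {b'} a<q a'<q eq =
  same-low , ℕ.*-cancelˡ-≡ b b' (suc q) (ℕ.+-cancelˡ-≡ a _ _ (trans eq (cong (_+ suc q * b') (sym same-low))))
  where
  low : ∀ {a b} → a < suc q → (a + suc q * b) % suc q ≡ a
  low {a} {b} a<q = trans (cong (λ x → (a + x) % suc q) (ℕ.*-comm (suc q) b))
                          (trans ([m+kn]%n≡m%n a b (suc q)) (m<n⇒m%n≡m a<q))
  same-low : a ≡ a'
  same-low = trans (sym (low a<q)) (trans (cong (_% suc q) eq) (low a'<q))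

digits-bound : ∀ {q p a b} → a < q → b < p → a + q * b < q * p
digits-bound {q} {p} {a} {b} a<q b<p = ℕ.<-≤-trans (ℕ.+-monoˡ-< (q * b) a<q)
  (ℕ.≤-trans (ℕ.≤-reflexive (sym (ℕ.*-suc q b))) (ℕ.*-monoʳ-≤ q b<p))

module Star {n : ℕ} (G : Graph n) where

  neighbours : Fin n → List (Fin n)
  neighbours v = filterᵇ (adj G v) (allFin n)

  -- the t-th neighbour of v (deg G v is by definition the length of `neighbours v`)
  neighbour : ∀ v → Fin (deg G v) → Fin n
  neighbour v = lookup (neighbours v)

  neighbour-adj : ∀ v t → T (adj G v (neighbour v t))
  neighbour-adj v t = proj₂ (∈-filter⁻ (T? ∘ adj G v) {xs = allFin n} (∈-lookup t))

  neighbour-injective : ∀ v {t t'} → neighbour v t ≡ neighbour v t' → t ≡ t'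
  neighbour-injective v = lookup-injective (filter⁺ (T? ∘ adj G v) (allFin⁺ n))

  slot : ∀ {v u} → T (adj G v u) → Fin (deg G v)
  slot {v} {u} a = Any.index (∈-filter⁺ (T? ∘ adj G v) (∈-allFin u) a)

  slot-injective : ∀ {v v' u u'} → v ≡ v' → (a : T (adj G v u)) (a' : T (adj G v' u')) →
    toℕ (slot a) ≡ toℕ (slot a') → u ≡ u'
  slot-injective refl a a' eq = index-injective (setoid (Fin n)) _ _ (toℕ-injective eq)

  adj-sym : ∀ {u v} → T (adj G u v) → T (adj G v u)
  adj-sym {u} {v} = subst T (symm G u v)

  star-saturated : ∀ v (g : Fin n → ℕ) →
    (∀ u → T (adj G v u) → g u < deg G v) →
    (∀ u u' → T (adj G v u) → T (adj G v u') → g u ≡ g u' → u ≡ u') →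
    ∀ c → c < deg G v → ∃ λ u → T (adj G v u) × g u ≡ c
  star-saturated v g g< g-inj c c< = neighbour v (proj₁ hit) , neighbour-adj v (proj₁ hit) , hits-c
    where
    -- g read along the enumeration of the star: an injective endomap of Fin (deg G v)
    h : Fin (deg G v) → Fin (deg G v)
    h t = fromℕ< (g< _ (neighbour-adj v t))
    h-injective : ∀ {t t'} → h t ≡ h t' → t ≡ t'
    h-injective {t} {t'} eq = neighbour-injective v (g-inj _ _ (neighbour-adj v t) (neighbour-adj v t')
      (trans (sym (toℕ-fromℕ< _)) (trans (cong toℕ eq) (toℕ-fromℕ< _))))
    hit : ∃ λ t → h t ≡ fromℕ< c<
    hit = injective⇒surjective h h-injective (fromℕ< c<)
    hits-c : g (neighbour v (proj₁ hit)) ≡ c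
    hits-c = trans (sym (toℕ-fromℕ< _)) (trans (cong toℕ (proj₂ hit)) (toℕ-fromℕ< c<))

module PaletteCounting {n : ℕ} {G : Graph n} (ψ : ProperEdgeColouring G) where
  open Star G

  colour-injective : ∀ {v u u'} → T (adj G v u) → T (adj G v u') → col ψ v u ≡ col ψ v u' → u ≡ u'
  colour-injective {v} {u} {u'} a a' eq with u ≟F u'
  ... | yes u≡u' = u≡u'
  ... | no  u≢u' = ⊥-elim (proper ψ v u u' a a' u≢u' eq)

  paletteSlot : ∀ {v c} → InPalette ψ v c → Fin (deg G v)
  paletteSlot (_ , a , _) = slot a

  paletteSlot-injective : ∀ {v v' c c'} → v ≡ v' → (p : InPalette ψ v c) (p' : InPalette ψ v' c') →
    toℕ (paletteSlot p) ≡ toℕ (paletteSlot p') → c ≡ c'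
  paletteSlot-injective refl (u , a , refl) (u' , a' , refl) eq
    with slot-injective refl a a' eq
  ... | refl = refl

  palette⊆⇒deg≤ : ∀ v w → (∀ c → InPalette ψ v c → InPalette ψ w c) → deg G v ≤ deg G w
  palette⊆⇒deg≤ v w v⊆w = injective⇒≤ {f = into} into-injective
    where
    atW : ∀ t → InPalette ψ w (col ψ v (neighbour v t))
    atW t = v⊆w _ (neighbour v t , neighbour-adj v t , refl)
    into : Fin (deg G v) → Fin (deg G w)
    into t = paletteSlot (atW t)
    into-injective : ∀ {t t'} → into t ≡ into t' → t ≡ t'
    into-injective {t} {t'} eq = neighbour-injective v
      (colour-injective (neighbour-adj v t) (neighbour-adj v t')
        (paletteSlot-injective refl (atW t) (atW t') (cong toℕ eq)))

  -- If y has degree D and all its neighbours have degree at most d < D, then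
  -- a colouring with at most 1 + j palettes has D ≤ j * d: the neighbours of y
  -- avoid the palette of y, and each of the j remaining palettes holds at most
  -- d of the D colours at y.
  palettes-lower-bound : ∀ y {d j} → (∀ x → T (adj G y x) → deg G x ≤ d) → d < deg G y →
    AtMostPalettes ψ (suc j) → deg G y ≤ j * d
  palettes-lower-bound y {d} {j} small d<D (label , same) = injective⇒≤ {f = code} code-injective
    where
    x : Fin (deg G y) → Fin n
    x = neighbour y

    y-x : ∀ t → T (adj G y (x t))
    y-x = neighbour-adj y

    label≢ : ∀ t → label y ≢ label (x t)
    label≢ t eq = ℕ.<⇒≱ d<D (ℕ.≤-trans
      (palette⊆⇒deg≤ y (x t) (λ c → Equivalence.to (same y (x t) eq c))) (small (x t) (y-x t)))

    -- a neighbour chosen canonically among those with the label of x t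
    labelled? : ∀ ℓ → Decidable (λ s → label (x s) ≡ ℓ)
    labelled? ℓ s = label (x s) ≟F ℓ

    rep : Fin (deg G y) → Fin (deg G y)
    rep t = witness (labelled? (label (x t))) t

    rep-label : ∀ t → label (x (rep t)) ≡ label (x t)
    rep-label t = witness-holds (labelled? (label (x t))) t (t , refl)

    rep-cong : ∀ {t t'} → label (x t) ≡ label (x t') → rep t ≡ rep t'
    rep-cong {t} {t'} eq = trans (cong (λ ℓ → witness (labelled? ℓ) t) eq)
                                 (witness-default (labelled? (label (x t'))) t t' (t' , refl))

    inRep : ∀ t → InPalette ψ (x (rep t)) (col ψ y (x t))
    inRep t = Equivalence.to (same (x t) (x (rep t)) (sym (rep-label t)) _)
      (y , adj-sym (y-x t) , sym (col-sym ψ y (x t) (y-x t)))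

    -- record the label of x t (which differs from that of y) and the slot
    -- of the colour of y (x t) at the representative of that label
    code : Fin (deg G y) → Fin (j * d)
    code t = combine (punchOut (label≢ t)) (inject≤ (paletteSlot (inRep t)) (small _ (y-x (rep t))))

    code-injective : ∀ {t t'} → code t ≡ code t' → t ≡ t'
    code-injective {t} {t'} eq with combine-injective _ _ _ _ eq
    ... | same-punched , same-injected = neighbour-injective y (colour-injective (y-x t) (y-x t')
          (paletteSlot-injective (cong x (rep-cong same-label)) (inRep t) (inRep t') same-slot))
      where
      same-label : label (x t) ≡ label (x t')
      same-label = punchOut-injective (label≢ t) (label≢ t') same-punched
      same-slot : toℕ (paletteSlot (inRep t)) ≡ toℕ (paletteSlot (inRep t'))
      same-slot = trans (sym (toℕ-inject≤ _ _)) (trans (cong toℕ same-injected) (toℕ-inject≤ _ _))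

-- Edge colourings of bipartite multigraphs
--
-- The edges of a multigraph are the elements of Fin m satisfying a predicate
-- E; an edge e joins the vertices left e and right e of two (abstract) sides.
-- Colours are natural numbers.

module _ {m : ℕ} where

  Separates : {V : Set} → (Fin m → Set) → (Fin m → V) → (Fin m → ℕ) → Set
  Separates S end c = ∀ e f → S e → S f → e ≢ f → end e ≡ end f → c e ≢ c f

  Bounded : (Fin m → Set) → ℕ → (Fin m → ℕ) → Set
  Bounded S Δ c = ∀ e → S e → c e < Δ

  Misses : {V : Set} → (Fin m → Set) → (Fin m → V) → (Fin m → ℕ) → V → ℕ → Set
  Misses S end c w γ = ∀ e → S e → end e ≡ w → c e ≢ γ

  -- every vertex is the end of at most Δ edges of E, as witnessed by an
  -- injective labelling of each star by numbers below Δ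
  DegreeAtMost : {V : Set} → (Fin m → Set) → (Fin m → V) → ℕ → Set
  DegreeAtMost E end Δ = Σ ((e : Fin m) → E e → ℕ) λ label →
    (∀ e p → label e p < Δ) × (∀ e f p q → e ≢ f → end e ≡ end f → label e p ≢ label f q)

  degree-mono : ∀ {V : Set} {E : Fin m → Set} {end : Fin m → V} {Δ Δ'} →
    Δ ≤ Δ' → DegreeAtMost E end Δ → DegreeAtMost E end Δ'
  degree-mono Δ≤Δ' (label , label< , label-inj) = label , (λ e p → ℕ.<-≤-trans (label< e p) Δ≤Δ') , label-inj

  separated-unique : ∀ {V : Set} {S : Fin m → Set} {end : Fin m → V} {c : Fin m → ℕ} →
    Separates S end c → ∀ {e f} → S e → S f → end e ≡ end f → c e ≡ c f → e ≡ f
  separated-unique sep {e} {f} se sf same-end same-colour with e ≟F f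
  ... | yes e≡f = e≡f
  ... | no  e≢f = ⊥-elim (sep e f se sf e≢f same-end same-colour)

  star-size : ∀ {V : Set} {E : Fin m → Set} {end : Fin m → V} {Δ N} → DegreeAtMost E end Δ →
    ∀ {w} (star : Fin N → Fin m) → (∀ {i j} → star i ≡ star j → i ≡ j) →
    (∀ i → E (star i)) → (∀ i → end (star i) ≡ w) → N ≤ Δ
  star-size (label , label< , label-inj) star star-inj edge at-w =
    injective⇒≤ {f = λ i → fromℕ< (label< _ (edge i))} labels-injective
    where
    labels-injective : ∀ {i j} → fromℕ< (label< _ (edge i)) ≡ fromℕ< (label< _ (edge j)) → i ≡ j
    labels-injective {i} {j} eq with star i ≟F star j
    ... | yes same = star-inj same
    ... | no  diff = ⊥-elim (label-inj _ _ (edge i) (edge j) diff (trans (at-w i) (sym (at-w j)))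
                       (trans (sym (toℕ-fromℕ< _)) (trans (cong toℕ eq) (toℕ-fromℕ< _))))

  used? : ∀ {V : Set} → DecidableEquality V → {S : Fin m → Set} → Decidable S → (end : Fin m → V) →
    (c : Fin m → ℕ) → (w : V) → ∀ {Δ} → Decidable (λ (α : Fin Δ) → ∃ λ e → S e × end e ≡ w × c e ≡ toℕ α)
  used? _≟V_ S? end c w α = any? λ e → S? e ×-dec ((end e ≟V w) ×-dec (c e ℕ.≟ toℕ α))

  free-colour : ∀ {V : Set} (_≟V_ : DecidableEquality V) {E S : Fin m → Set} {end : Fin m → V} {Δ}
    (c : Fin m → ℕ) → DegreeAtMost E end Δ → Decidable S → (∀ {e} → S e → E e) →
    ∀ {e₀} → E e₀ → ¬ S e₀ → Σ ℕ λ α → α < Δ × Misses S end c (end e₀) α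
  free-colour {V} _≟V_ {E} {S} {end} {Δ} c degree S? S⊆E {e₀} E-e₀ e₀∉S
    with all? (used? _≟V_ S? end c (end e₀) {Δ})
  ... | no ¬all-used with ¬∀⟶∃¬ Δ _ (used? _≟V_ S? end c (end e₀)) ¬all-used
  ...   | α , unused = toℕ α , toℕ<n α , λ e se at-e₀ cα → unused (e , se , at-e₀ , cα)
  free-colour {V} _≟V_ {E} {S} {end} {Δ} c degree S? S⊆E {e₀} E-e₀ e₀∉S | yes all-used =
    ⊥-elim (ℕ.<-irrefl refl (star-size degree star star-injective edge at-e₀))
    where
    -- e₀ together with one edge of S at end e₀ for each colour: Δ + 1 distinct edges
    star : Fin (suc Δ) → Fin m
    star fzero    = e₀
    star (fsuc α) = proj₁ (all-used α)
    edge : ∀ i → E (star i)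
    edge fzero    = E-e₀
    edge (fsuc α) = S⊆E (proj₁ (proj₂ (all-used α)))
    at-e₀ : ∀ i → end (star i) ≡ end e₀
    at-e₀ fzero    = refl
    at-e₀ (fsuc α) = proj₁ (proj₂ (proj₂ (all-used α)))
    star-injective : ∀ {i j} → star i ≡ star j → i ≡ j
    star-injective {fzero}  {fzero}  _  = refl
    star-injective {fzero}  {fsuc β} eq = ⊥-elim (e₀∉S (subst S (sym eq) (proj₁ (proj₂ (all-used β)))))
    star-injective {fsuc α} {fzero}  eq = ⊥-elim (e₀∉S (subst S eq (proj₁ (proj₂ (all-used α)))))
    star-injective {fsuc α} {fsuc β} eq = cong fsuc (toℕ-injective
      (trans (sym (proj₂ (proj₂ (proj₂ (all-used α)))))
             (trans (cong c eq) (proj₂ (proj₂ (proj₂ (all-used β)))))))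

module EdgeSearch {V : Set} (_≟V_ : DecidableEquality V) {m : ℕ}
  {S : Fin m → Set} (S? : Decidable S) (end : Fin m → V) (c : Fin m → ℕ)
  (separated : Separates S end c) where

  find : V → ℕ → Maybe (Fin m)
  find w γ with any? (λ e → S? e ×-dec ((end e ≟V w) ×-dec (c e ℕ.≟ γ)))
  ... | yes (e , _) = just e
  ... | no _        = nothing

  find-sound : ∀ {w γ e} → find w γ ≡ just e → S e × end e ≡ w × c e ≡ γ
  find-sound {w} {γ} eq with any? (λ e → S? e ×-dec ((end e ≟V w) ×-dec (c e ℕ.≟ γ)))
  find-sound refl | yes (_ , found) = found
  find-sound ()   | no _

  find-complete : ∀ {w γ e} → S e → end e ≡ w → c e ≡ γ → find w γ ≡ just e
  find-complete {w} {γ} se at-w cγ with any? (λ e → S? e ×-dec ((end e ≟V w) ×-dec (c e ℕ.≟ γ)))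
  ... | yes (e' , se' , at-w' , cγ') =
        cong just (separated-unique separated se' se (trans at-w' (sym at-w)) (trans cγ' (sym cγ)))
  ... | no none = ⊥-elim (none (_ , se , at-w , cγ))

-- Exchanging α and β along the
-- alternating path that leaves v by its α-edge keeps c separating, makes α
-- missing at v, and keeps α missing at every left vertex where it was missing.
module KempeSwap {L R : Set} (_≟L_ : DecidableEquality L) (_≟R_ : DecidableEquality R)
  {m : ℕ} (left : Fin m → L) (right : Fin m → R)
  {S : Fin m → Set} (S? : Decidable S) (c : Fin m → ℕ)
  (separatedL : Separates S left c) (separatedR : Separates S right c)
  (α β : ℕ) (α≢β : α ≢ β) (v : R) (β-free : Misses S right c v β) where

  open EdgeSearch _≟L_ S? left  c separatedL renaming (find to findL; find-sound to findL-sound; find-complete to findL-complete)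
  open EdgeSearch _≟R_ S? right c separatedR renaming (find to findR; find-sound to findR-sound; find-complete to findR-complete)

  AB : ℕ → Set
  AB γ = γ ≡ α ⊎ γ ≡ β

  next : Fin m → Maybe (Fin m)
  next e with c e ℕ.≟ α
  ... | yes _ = findL (left e) β
  ... | no  _ = findR (right e) α

  path : ℕ → Maybe (Fin m)
  path zero    = findR v α
  path (suc i) = path i >>= next

  OnPath : Fin m → Set
  OnPath e = ∃ λ i → path i ≡ just e

  next-α : ∀ {e} → c e ≡ α → next e ≡ findL (left e) β
  next-α {e} cα with c e ℕ.≟ α
  ... | yes _  = refl
  ... | no c≢α = ⊥-elim (c≢α cα)

  next-β : ∀ {e} → c e ≡ β → next e ≡ findR (right e) α
  next-β {e} cβ with c e ℕ.≟ α
  ... | yes cα = ⊥-elim (α≢β (trans (sym cα) cβ))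
  ... | no _   = refl

  path-start : ∀ {e} → path 0 ≡ just e → S e × right e ≡ v × c e ≡ α
  path-start = findR-sound

  path-edge : ∀ i {e} → path i ≡ just e → S e × AB (c e)

  entered : ∀ i {f} → path (suc i) ≡ just f → Σ (Fin m) λ e → path i ≡ just e × S f ×
    ((c e ≡ α × left f ≡ left e × c f ≡ β) ⊎ (c e ≡ β × right f ≡ right e × c f ≡ α))
  entered i {f} eq with path i in at-i
  entered i () | nothing
  ... | just e with path-edge i at-i
  ...   | _ , inj₁ cα with findL-sound (trans (sym (next-α cα)) eq)
  ...     | sf , left-f , cβ = e , refl , sf , inj₁ (cα , left-f , cβ)
  entered i {f} eq | just e | _ , inj₂ cβ with findR-sound (trans (sym (next-β cβ)) eq)
  ...     | sf , right-f , cα = e , refl , sf , inj₂ (cβ , right-f , cα)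

  path-edge zero    eq = let (se , _ , cα) = path-start eq in se , inj₁ cα
  path-edge (suc i) eq with entered i eq
  ... | _ , _ , sf , inj₁ (_ , _ , cβ) = sf , inj₂ cβ
  ... | _ , _ , sf , inj₂ (_ , _ , cα) = sf , inj₁ cα

  S-on : ∀ {e} → OnPath e → S e
  S-on (i , p) = proj₁ (path-edge i p)

  AB-on : ∀ {e} → OnPath e → AB (c e)
  AB-on (i , p) = proj₂ (path-edge i p)

  continues-left : ∀ i {e f} → path i ≡ just e → c e ≡ α → S f → left f ≡ left e → c f ≡ β → path (suc i) ≡ just f
  continues-left i pe cα sf same cβ = trans (cong (_>>= next) pe) (trans (next-α cα) (findL-complete sf same cβ))

  continues-right : ∀ i {e f} → path i ≡ just e → c e ≡ β → S f → right f ≡ right e → c f ≡ α → path (suc i) ≡ just f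
  continues-right i pe cβ sf same cα = trans (cong (_>>= next) pe) (trans (next-β cβ) (findR-complete sf same cα))

  β-entered : ∀ i {f} → path i ≡ just f → c f ≡ β →
    Σ (Fin m) λ e → OnPath e × S e × left e ≡ left f × c e ≡ α
  β-entered zero p cβ = ⊥-elim (α≢β (trans (sym (proj₂ (proj₂ (path-start p)))) cβ))
  β-entered (suc i) p cβ with entered i p
  ... | e , pe , _ , inj₁ (cα , same , _) = e , (i , pe) , S-on (i , pe) , sym same , cα
  ... | _ , _  , _ , inj₂ (_ , _ , cα)    = ⊥-elim (α≢β (trans (sym cα) cβ))

  α-entered : ∀ i {f} → path i ≡ just f → c f ≡ α →
    right f ≡ v ⊎ Σ (Fin m) λ e → OnPath e × S e × right e ≡ right f × c e ≡ β
  α-entered zero p cα = inj₁ (proj₁ (proj₂ (path-start p)))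
  α-entered (suc i) p cα with entered i p
  ... | _ , _  , _ , inj₁ (_ , _ , cβ)    = ⊥-elim (α≢β (trans (sym cα) cβ))
  ... | e , pe , _ , inj₂ (cβ , same , _) = inj₂ (e , (i , pe) , S-on (i , pe) , sym same , cβ)

  start-not-revisited : ∀ j {e} → path 0 ≡ just e → path (suc j) ≢ just e
  start-not-revisited j p q with entered j q
  ... | _ , _ , _ , inj₁ (_ , _ , cβ) = α≢β (trans (sym (proj₂ (proj₂ (path-start p)))) cβ)
  ... | e , pe , _ , inj₂ (cβ , same , _) =
        β-free e (S-on (j , pe)) (trans (sym same) (proj₁ (proj₂ (path-start p)))) cβ

  path-injective : ∀ i j {e} → path i ≡ just e → path j ≡ just e → i ≡ j
  path-injective zero    zero    p q = refl
  path-injective zero    (suc j) p q = ⊥-elim (start-not-revisited j p q)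
  path-injective (suc i) zero    p q = ⊥-elim (start-not-revisited i q p)
  path-injective (suc i) (suc j) p q with entered i p | entered j q
  ... | e , pe , _ , inj₁ (cα , same , _) | e' , pe' , _ , inj₁ (cα' , same' , _)
        with separated-unique separatedL (S-on (i , pe)) (S-on (j , pe')) (trans (sym same) same') (trans cα (sym cα'))
  ...   | refl = cong suc (path-injective i j pe pe')
  path-injective (suc i) (suc j) p q | e , pe , _ , inj₂ (cβ , same , _) | e' , pe' , _ , inj₂ (cβ' , same' , _)
        with separated-unique separatedR (S-on (i , pe)) (S-on (j , pe')) (trans (sym same) same') (trans cβ (sym cβ'))
  ...   | refl = cong suc (path-injective i j pe pe')
  path-injective (suc i) (suc j) p q | _ , _ , _ , inj₁ (_ , _ , cβ) | _ , _ , _ , inj₂ (_ , _ , cα) =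
    ⊥-elim (α≢β (trans (sym cα) cβ))
  path-injective (suc i) (suc j) p q | _ , _ , _ , inj₂ (_ , _ , cα) | _ , _ , _ , inj₁ (_ , _ , cβ) =
    ⊥-elim (α≢β (trans (sym cα) cβ))

  defined-below : ∀ i j {e} → j ≤ i → path i ≡ just e → ∃ λ e' → path j ≡ just e'
  defined-below i       j j≤i p with ℕ.m≤n⇒m<n∨m≡n j≤i
  defined-below i       j j≤i p | inj₂ refl = _ , p
  defined-below (suc i) j j≤i p | inj₁ j<1+i = defined-below i j (ℕ.≤-pred j<1+i) (proj₁ (proj₂ (entered i p)))

  -- the path has fewer than m edges, being a sequence of distinct edges
  path-bound : ∀ i {e} → path i ≡ just e → i < m
  path-bound i p = injective⇒≤ {f = earlier} earlier-injective
    where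
    earlier : Fin (suc i) → Fin m
    earlier k = proj₁ (defined-below i (toℕ k) (ℕ.≤-pred (toℕ<n k)) p)
    earlier-injective : ∀ {k k'} → earlier k ≡ earlier k' → k ≡ k'
    earlier-injective {k} {k'} eq = toℕ-injective (path-injective (toℕ k) (toℕ k')
      (proj₂ (defined-below i (toℕ k) _ p))
      (subst (λ e → path (toℕ k') ≡ just e) (sym eq) (proj₂ (defined-below i (toℕ k') _ p))))

  -- being on the path is decidable, as only its first m positions matter
  OnPath? : Decidable OnPath
  OnPath? e with any? (λ (k : Fin m) → ≡-dec _≟F_ (path (toℕ k)) (just e))
  ... | yes (k , p) = yes (toℕ k , p)
  ... | no  none    = no λ { (i , p) → none (fromℕ< (path-bound i p) ,
                              subst (λ j → path j ≡ just e) (sym (toℕ-fromℕ< (path-bound i p))) p) }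

  flip : ℕ → ℕ
  flip γ with γ ℕ.≟ α
  ... | yes _ = β
  ... | no  _ = α

  flip-AB : ∀ γ → AB (flip γ)
  flip-AB γ with γ ℕ.≟ α
  ... | yes _ = inj₂ refl
  ... | no  _ = inj₁ refl

  flip-α : flip α ≡ β
  flip-α with α ℕ.≟ α
  ... | yes _ = refl
  ... | no α≢α = ⊥-elim (α≢α refl)

  flip-β : flip β ≡ α
  flip-β with β ℕ.≟ α
  ... | yes β≡α = ⊥-elim (α≢β (sym β≡α))
  ... | no _    = refl

  flip-injective : ∀ {γ γ'} → AB γ → AB γ' → flip γ ≡ flip γ' → γ ≡ γ'
  flip-injective (inj₁ refl) (inj₁ refl) _  = refl
  flip-injective (inj₂ refl) (inj₂ refl) _  = refl
  flip-injective (inj₁ refl) (inj₂ refl) eq = ⊥-elim (α≢β (trans (sym flip-β) (trans (sym eq) flip-α)))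
  flip-injective (inj₂ refl) (inj₁ refl) eq = ⊥-elim (α≢β (trans (sym flip-β) (trans eq flip-α)))

  flip-to-α : ∀ {γ} → AB γ → flip γ ≡ α → γ ≡ β
  flip-to-α (inj₁ refl) eq = ⊥-elim (α≢β (trans (sym eq) flip-α))
  flip-to-α (inj₂ refl) _  = refl

  swapped : Fin m → ℕ
  swapped e with OnPath? e
  ... | yes _ = flip (c e)
  ... | no  _ = c e

  closed-left : ∀ {e f} → OnPath e → S f → f ≢ e → left e ≡ left f → AB (c f) → OnPath f
  closed-left (i , pe) sf f≢e same cf with path-edge i pe | cf
  ... | se , inj₁ cα | inj₁ cfα = ⊥-elim (f≢e (separated-unique separatedL sf se (sym same) (trans cfα (sym cα))))
  ... | se , inj₁ cα | inj₂ cfβ = suc i , continues-left i pe cα sf (sym same) cfβ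
  ... | se , inj₂ cβ | inj₂ cfβ = ⊥-elim (f≢e (separated-unique separatedL sf se (sym same) (trans cfβ (sym cβ))))
  ... | se , inj₂ cβ | inj₁ cfα with β-entered i pe cβ
  ...   | e' , on-e' , se' , same' , cα'
          with separated-unique separatedL sf se' (trans (sym same) (sym same')) (trans cfα (sym cα'))
  ...     | refl = on-e'

  closed-right : ∀ {e f} → OnPath e → S f → f ≢ e → right e ≡ right f → AB (c f) → OnPath f
  closed-right (i , pe) sf f≢e same cf with path-edge i pe | cf
  ... | se , inj₂ cβ | inj₂ cfβ = ⊥-elim (f≢e (separated-unique separatedR sf se (sym same) (trans cfβ (sym cβ))))
  ... | se , inj₂ cβ | inj₁ cfα = suc i , continues-right i pe cβ sf (sym same) cfα
  ... | se , inj₁ cα | inj₁ cfα = ⊥-elim (f≢e (separated-unique separatedR sf se (sym same) (trans cfα (sym cα))))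
  ... | se , inj₁ cα | inj₂ cfβ with α-entered i pe cα
  ...   | inj₁ at-v = ⊥-elim (β-free _ sf (trans (sym same) at-v) cfβ)
  ...   | inj₂ (e' , on-e' , se' , same' , cβ')
          with separated-unique separatedR sf se' (trans (sym same) (sym same')) (trans cfβ (sym cβ'))
  ...     | refl = on-e'

  swapped-separates : ∀ {V : Set} (end : Fin m → V) → Separates S end c →
    (∀ {e f} → OnPath e → S f → f ≢ e → end e ≡ end f → AB (c f) → OnPath f) →
    Separates S end swapped
  swapped-separates end separated closed e f se sf e≢f same with OnPath? e | OnPath? f
  ... | yes on-e | yes on-f = λ eq → separated e f se sf e≢f same (flip-injective (AB-on on-e) (AB-on on-f) eq)
  ... | no  _    | no  _    = separated e f se sf e≢f same
  ... | yes on-e | no off-f = λ eq → off-f (closed on-e sf (λ f≡e → e≢f (sym f≡e)) same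
                                        (subst AB eq (flip-AB (c e))))
  ... | no off-e | yes on-f = λ eq → off-e (closed on-f se e≢f (sym same) (subst AB (sym eq) (flip-AB (c f))))

  swapped-separatesL : Separates S left swapped
  swapped-separatesL = swapped-separates left separatedL closed-left

  swapped-separatesR : Separates S right swapped
  swapped-separatesR = swapped-separates right separatedR closed-right

  swapped-bounded : ∀ {Δ} → Bounded S Δ c → α < Δ → β < Δ → Bounded S Δ swapped
  swapped-bounded bounded α<Δ β<Δ e se with OnPath? e
  ... | no _ = bounded e se
  ... | yes _ with flip-AB (c e)
  ...   | inj₁ eq = subst (_< _) (sym eq) α<Δ
  ...   | inj₂ eq = subst (_< _) (sym eq) β<Δ

  swapped-α-free : Misses S right swapped v α
  swapped-α-free e se at-v with OnPath? e
  ... | yes on-e = λ eq → β-free e se at-v (flip-to-α (AB-on on-e) eq)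
  ... | no off-e = λ cα → off-e (0 , findR-complete se at-v cα)

  swapped-keeps-α-free : ∀ u → Misses S left c u α → Misses S left swapped u α
  swapped-keeps-α-free u α-free e se at-u with OnPath? e
  ... | no _ = α-free e se at-u
  ... | yes (i , pe) = λ eq → let (e' , _ , se' , same , cα) = β-entered i pe (flip-to-α (AB-on (i , pe)) eq)
                              in α-free e' se' (trans same at-u) cα

-- The edges are coloured one at a time; before colouring e₀ a Kempe swap
-- produces a colour missing at both of its ends.
module König {L R : Set} (_≟L_ : DecidableEquality L) (_≟R_ : DecidableEquality R)
  {m : ℕ} {E : Fin m → Set} (E? : Decidable E) (left : Fin m → L) (right : Fin m → R) {Δ : ℕ}
  (degreeL : DegreeAtMost E left Δ) (degreeR : DegreeAtMost E right Δ) where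

  ColouringOf : (Fin m → Set) → (Fin m → ℕ) → Set
  ColouringOf S c = Bounded S Δ c × Separates S left c × Separates S right c

  restrict : ∀ {S S' : Fin m → Set} {c} → (∀ {e} → S' e → S e) → ColouringOf S c → ColouringOf S' c
  restrict S'⊆S (bounded , sepL , sepR) =
    (λ e s' → bounded e (S'⊆S s')) ,
    (λ e f s' t' → sepL e f (S'⊆S s') (S'⊆S t')) ,
    (λ e f s' t' → sepR e f (S'⊆S s') (S'⊆S t'))

  common-free-colour : ∀ {S : Fin m → Set} → Decidable S → (∀ {e} → S e → E e) →
    ∀ {c} → ColouringOf S c → ∀ {e₀} → E e₀ → ¬ S e₀ →
    Σ (Fin m → ℕ) λ c' → ColouringOf S c' ×
      Σ ℕ λ α → α < Δ × Misses S left c' (left e₀) α × Misses S right c' (right e₀) α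
  common-free-colour S? S⊆E {c} (bounded , sepL , sepR) E-e₀ e₀∉S
    with free-colour _≟L_ c degreeL S? S⊆E E-e₀ e₀∉S | free-colour _≟R_ c degreeR S? S⊆E E-e₀ e₀∉S
  ... | α , α<Δ , α-freeL | β , β<Δ , β-freeR with α ℕ.≟ β
  ...   | yes refl = c , (bounded , sepL , sepR) , α , α<Δ , α-freeL , β-freeR
  ...   | no  α≢β  = swapped , (swapped-bounded bounded α<Δ β<Δ , swapped-separatesL , swapped-separatesR) ,
                     α , α<Δ , swapped-keeps-α-free _ α-freeL , swapped-α-free
    where open KempeSwap _≟L_ _≟R_ left right S? c sepL sepR α β α≢β _ β-freeR

  recolour : Fin m → ℕ → (Fin m → ℕ) → Fin m → ℕ
  recolour e₀ α c e with e ≟F e₀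
  ... | yes _ = α
  ... | no  _ = c e

  old-edge : ∀ (S : Fin m → Set) {e₀ x} → S x ⊎ x ≡ e₀ → x ≢ e₀ → S x
  old-edge S (inj₁ s)    _    = s
  old-edge S (inj₂ x≡e₀) x≢e₀ = ⊥-elim (x≢e₀ x≡e₀)

  recolour-separates : ∀ {V : Set} {S : Fin m → Set} (end : Fin m → V) {c e₀ α} →
    Separates S end c → Misses S end c (end e₀) α →
    Separates (λ e → S e ⊎ e ≡ e₀) end (recolour e₀ α c)
  recolour-separates {S = S} end {c} {e₀} {α} separated α-free e f se sf e≢f same
    with e ≟F e₀ | f ≟F e₀
  ... | yes refl | yes refl = ⊥-elim (e≢f refl)
  ... | yes refl | no f≢e₀  = λ α≡cf → α-free f (old-edge S sf f≢e₀) (sym same) (sym α≡cf)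
  ... | no e≢e₀  | yes refl = α-free e (old-edge S se e≢e₀) same
  ... | no e≢e₀  | no f≢e₀  = separated e f (old-edge S se e≢e₀) (old-edge S sf f≢e₀) e≢f same

  recolour-bounded : ∀ {S : Fin m → Set} {c e₀ α} → Bounded S Δ c → α < Δ →
    Bounded (λ e → S e ⊎ e ≡ e₀) Δ (recolour e₀ α c)
  recolour-bounded {S} {c} {e₀} bounded α<Δ e se with e ≟F e₀
  ... | yes _    = α<Δ
  ... | no e≢e₀ = bounded e (old-edge S se e≢e₀)

  add-edge : ∀ {S : Fin m → Set} → Decidable S → (∀ {e} → S e → E e) →
    ∀ {c} → ColouringOf S c → ∀ {e₀} → E e₀ → ¬ S e₀ →
    Σ (Fin m → ℕ) (ColouringOf (λ e → S e ⊎ e ≡ e₀))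
  add-edge S? S⊆E colouring E-e₀ e₀∉S with common-free-colour S? S⊆E colouring E-e₀ e₀∉S
  ... | c' , (bounded , sepL , sepR) , α , α<Δ , α-freeL , α-freeR =
        recolour _ α c' , recolour-bounded bounded α<Δ ,
        recolour-separates left sepL α-freeL , recolour-separates right sepR α-freeR

  Earlier : ℕ → Fin m → Set
  Earlier k e = E e × toℕ e < k

  Earlier? : ∀ k → Decidable (Earlier k)
  Earlier? k e = E? e ×-dec (toℕ e ℕ.<? k)

  colouring-up-to : ∀ k → Σ (Fin m → ℕ) (ColouringOf (Earlier k))
  colouring-up-to zero = (λ _ → 0) , (λ _ ()) , (λ _ _ ()) , (λ _ _ ())
  colouring-up-to (suc k) with colouring-up-to k | any? (λ e → E? e ×-dec (toℕ e ℕ.≟ k))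
  ... | c , colouring | no none = c , restrict earlier colouring
    where
    earlier : ∀ {e} → Earlier (suc k) e → Earlier k e
    earlier {e} (E-e , e<1+k) with ℕ.m≤n⇒m<n∨m≡n (ℕ.≤-pred e<1+k)
    ... | inj₁ e<k = E-e , e<k
    ... | inj₂ e≡k = ⊥-elim (none (e , E-e , e≡k))
  ... | c , colouring | yes (e₀ , E-e₀ , e₀≡k) =
        let (c' , coloured) = add-edge (Earlier? k) proj₁ colouring E-e₀ (λ (_ , e₀<k) → ℕ.<-irrefl e₀≡k e₀<k)
        in c' , restrict earlier-or-e₀ coloured
    where
    earlier-or-e₀ : ∀ {e} → Earlier (suc k) e → Earlier k e ⊎ e ≡ e₀
    earlier-or-e₀ {e} (E-e , e<1+k) with ℕ.m≤n⇒m<n∨m≡n (ℕ.≤-pred e<1+k)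
    ... | inj₁ e<k = inj₁ (E-e , e<k)
    ... | inj₂ e≡k = inj₂ (toℕ-injective (trans e≡k (sym e₀≡k)))

  colouring : Σ (Fin m → ℕ) λ c → Bounded E Δ c × Separates E left c × Separates E right c
  colouring with colouring-up-to m
  ... | c , coloured = c , restrict (λ {e} E-e → E-e , toℕ<n e) coloured

module Sides {n : ℕ} (G : Graph n) (side : Fin n → Bool)
  (bipartite : ∀ u v → T (adj G u v) → side u ≢ side v) where

  X : Fin n → Set
  X v = side v ≡ true

  X? : Decidable X
  X? v = side v Bool.≟ true

  X-or-Y : ∀ v → X v ⊎ side v ≡ false
  X-or-Y v with side v
  ... | true  = inj₁ refl
  ... | false = inj₂ refl

  X→Y : ∀ {x y} → X x → T (adj G x y) → side y ≡ false
  X→Y {x} {y} xx a with side y in sy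
  ... | false = refl
  ... | true  = ⊥-elim (bipartite x y a (trans xx (sym sy)))

  Y→X : ∀ {x y} → side y ≡ false → T (adj G y x) → X x
  Y→X {x} {y} yy a with side x in sx
  ... | true  = refl
  ... | false = ⊥-elim (bipartite y x a (trans yy (sym sx)))

module UpperBound (r : ℕ) (r>0 : 0 < r) {n : ℕ} (G : Graph n) (side : Fin n → Bool)
  (bipartite : ∀ u v → T (adj G u v) → side u ≢ side v)
  (degX : ∀ v → side v ≡ true → deg G v ≡ 5)
  (degY : ∀ v → side v ≡ false → deg G v ≡ 5 * r) where

  open Star G
  open Sides G side bipartite

  instance
    r-nonZero : NonZero r
    r-nonZero = >-nonZero r>0
    r³-nonZero : NonZero (r ^ 3)
    r³-nonZero = ℕ.m^n≢0 r 3

  -- Edges of G are indexed by Fin (n * n) through their ends (x , y), x ∈ X.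

  edge : Fin n → Fin n → Fin (n * n)
  edge = combine {n} {n}

  xOf yOf : Fin (n * n) → Fin n
  xOf e = proj₁ (remQuot {n} n e)
  yOf e = proj₂ (remQuot {n} n e)

  xOf-edge : ∀ x y → xOf (edge x y) ≡ x
  xOf-edge x y = cong proj₁ (remQuot-combine {n} {n} x y)

  yOf-edge : ∀ x y → yOf (edge x y) ≡ y
  yOf-edge x y = cong proj₂ (remQuot-combine {n} {n} x y)

  edge-ext : ∀ {e f} → xOf e ≡ xOf f → yOf e ≡ yOf f → e ≡ f
  edge-ext {e} {f} same-x same-y =
    trans (sym (combine-remQuot {n} n e)) (trans (cong₂ edge same-x same-y) (combine-remQuot {n} n f))

  IsEdge : Fin (n * n) → Set
  IsEdge e = X (xOf e) × T (adj G (xOf e) (yOf e))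

  IsEdge? : Decidable IsEdge
  IsEdge? e = X? (xOf e) ×-dec T? (adj G (xOf e) (yOf e))

  is-edge : ∀ {x y} → X x → T (adj G x y) → IsEdge (edge x y)
  is-edge {x} {y} xx a rewrite xOf-edge x y | yOf-edge x y = xx , a

  degree-at-x : DegreeAtMost IsEdge xOf 5
  degree-at-x = (λ e (_ , a) → toℕ (slot a)) ,
                (λ e (xx , a) → subst (toℕ (slot a) <_) (degX _ xx) (toℕ<n (slot a))) ,
                (λ e f (_ , a) (_ , a') e≢f same eq → e≢f (edge-ext same (slot-injective same a a' eq)))

  degree-at-y : DegreeAtMost IsEdge yOf (5 * r)
  degree-at-y = (λ e (_ , a) → toℕ (slot (adj-sym a))) ,
                (λ e (xx , a) → subst (toℕ (slot (adj-sym a)) <_) (degY _ (X→Y xx a)) (toℕ<n (slot (adj-sym a)))) ,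
                (λ e f (_ , a) (_ , a') e≢f same eq → e≢f (edge-ext (slot-injective same (adj-sym a) (adj-sym a') eq) same))

  5≤5r : 5 ≤ 5 * r
  5≤5r = ℕ.*-monoʳ-≤ 5 r>0

  -- (the König colourings are used only through their properties; making them
  -- opaque keeps the typechecker from unfolding the construction)
  opaque
    base : Σ (Fin (n * n) → ℕ) λ c → Bounded IsEdge (5 * r) c × Separates IsEdge xOf c × Separates IsEdge yOf c
    base = König.colouring _≟F_ _≟F_ IsEdge? xOf yOf (degree-mono 5≤5r degree-at-x) degree-at-y

  base-colour : Fin (n * n) → ℕ
  base-colour = proj₁ base

  -- the base colours come in r blocks of 5 consecutive colours
  block : Fin (n * n) → ℕ
  block e = base-colour e / 5

  block< : ∀ e → IsEdge e → block e < r
  block< e ie = m<n*o⇒m/o<n (subst (base-colour e <_) (ℕ.*-comm 5 r) (proj₁ (proj₂ base) e ie))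

  -- Step 2 (König): classes 0,…,4 such that every X-vertex meets one edge of each
  -- class and, at each Y-vertex, the 5 edges of a block have distinct classes.

  yBlock : Fin (n * n) → Fin n × ℕ
  yBlock e = yOf e , block e

  degree-at-y-block : DegreeAtMost IsEdge yBlock 5
  degree-at-y-block = (λ e _ → base-colour e % 5) , (λ e _ → m%n<n (base-colour e) 5) ,
    λ e f ie if e≢f same eq → proj₂ (proj₂ (proj₂ base)) e f ie if e≢f (cong proj₁ same)
      (trans (m≡m%n+[m/n]*n (base-colour e) 5)
        (trans (cong₂ (λ a b → a + b * 5) eq (cong proj₂ same)) (sym (m≡m%n+[m/n]*n (base-colour f) 5))))

  opaque
    classes : Σ (Fin (n * n) → ℕ) λ c → Bounded IsEdge 5 c × Separates IsEdge xOf c × Separates IsEdge yBlock c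
    classes = König.colouring _≟F_ (×-≡-dec _≟F_ ℕ._≟_) IsEdge? xOf yBlock degree-at-x degree-at-y-block

  class : Fin (n * n) → ℕ
  class = proj₁ classes

  class< : ∀ {x y} → X x → T (adj G x y) → class (edge x y) < 5
  class< xx a = proj₁ (proj₂ classes) _ (is-edge xx a)

  class-determines-y : ∀ {x y y'} → X x → T (adj G x y) → T (adj G x y') →
    class (edge x y) ≡ class (edge x y') → y ≡ y'
  class-determines-y {x} {y} {y'} xx a a' eq =
    trans (sym (yOf-edge x y)) (trans (cong yOf same-edge) (yOf-edge x y'))
    where
    same-edge : edge x y ≡ edge x y'
    same-edge = separated-unique (proj₁ (proj₂ (proj₂ classes))) (is-edge xx a) (is-edge xx a')
                  (trans (xOf-edge x y) (sym (xOf-edge x y'))) eq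

  class-neighbour : ∀ {x} → X x → ∀ {i} → i < 5 → ∃ λ y → T (adj G x y) × class (edge x y) ≡ i
  class-neighbour {x} xx {i} i<5 = star-saturated x (λ y → class (edge x y))
    (λ y a → subst (class (edge x y) <_) (sym (degX x xx)) (class< xx a))
    (λ y y' a a' → class-determines-y xx a a')
    i (subst (i <_) (sym (degX x xx)) i<5)

  partner : ℕ → Fin n → Fin n
  partner i x = witness (λ y → T? (adj G x y) ×-dec (class (edge x y) ℕ.≟ i)) x

  partner-spec : ∀ {x} → X x → ∀ {i} → i < 5 → T (adj G x (partner i x)) × class (edge x (partner i x)) ≡ i
  partner-spec xx i<5 = witness-holds _ _ (class-neighbour xx i<5)

  partner-unique : ∀ {x y} → X x → (a : T (adj G x y)) → y ≡ partner (class (edge x y)) x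
  partner-unique {x} {y} xx a = class-determines-y xx a (proj₁ spec) (sym (proj₂ spec))
    where
    spec : T (adj G x (partner (class (edge x y)) x)) × class (edge x (partner (class (edge x y)) x)) ≡ class (edge x y)
    spec = partner-spec xx (class< xx a)

  -- The X-vertices with a common partner y of class i lie in different blocks at y.

  degree-of-class : ∀ i → i < 5 → DegreeAtMost X (partner i) r
  degree-of-class i i<5 = (λ x _ → block (edge x (partner i x))) ,
    (λ x xx → block< _ (is-edge xx (proj₁ (partner-spec xx i<5)))) ,
    λ x x' xx xx' x≢x' same eq → proj₂ (proj₂ (proj₂ classes)) _ _
      (is-edge xx (proj₁ (partner-spec xx i<5))) (is-edge xx' (proj₁ (partner-spec xx' i<5)))
      (λ e≡e' → x≢x' (trans (sym (xOf-edge _ _)) (trans (cong xOf e≡e') (xOf-edge _ _))))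
      (cong₂ _,_ (trans (yOf-edge _ _) (trans same (sym (yOf-edge _ _)))) eq)
      (trans (proj₂ (partner-spec xx i<5)) (sym (proj₂ (partner-spec xx' i<5))))

  PairColouring : ℕ → ℕ → Set
  PairColouring i j = Σ (Fin n → ℕ) λ K → Bounded X r K × Separates X (partner i) K × Separates X (partner j) K

  opaque
    pair-colouring : ∀ i j → i < 5 → j < 5 → PairColouring i j
    pair-colouring i j i<5 j<5 =
      König.colouring _≟F_ _≟F_ X? (partner i) (partner j) (degree-of-class i i<5) (degree-of-class j j<5)

  -- classes 0,1 share one r-colouring, classes 2,3 a second, class 4 a third;
  -- three colourings give r³ combinations, where five would give r⁵
  K01 : PairColouring 0 1
  K23 : PairColouring 2 3
  K4  : PairColouring 4 4
  K01 = pair-colouring 0 1 (s≤s z≤n) (s≤s (s≤s z≤n))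
  K23 = pair-colouring 2 3 (s≤s (s≤s (s≤s z≤n))) (s≤s (s≤s (s≤s (s≤s z≤n))))
  K4  = pair-colouring 4 4 ℕ.≤-refl ℕ.≤-refl

  K : ℕ → Fin n → ℕ
  K 0 = proj₁ K01
  K 1 = proj₁ K01
  K 2 = proj₁ K23
  K 3 = proj₁ K23
  K _ = proj₁ K4

  K< : ∀ i {x} → X x → K i x < r
  K< 0 xx = proj₁ (proj₂ K01) _ xx
  K< 1 xx = proj₁ (proj₂ K01) _ xx
  K< 2 xx = proj₁ (proj₂ K23) _ xx
  K< 3 xx = proj₁ (proj₂ K23) _ xx
  K< (suc (suc (suc (suc _)))) xx = proj₁ (proj₂ K4) _ xx

  K-separates : ∀ i → i < 5 → Separates X (partner i) (K i)
  K-separates 0 _ = proj₁ (proj₂ (proj₂ K01))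
  K-separates 1 _ = proj₂ (proj₂ (proj₂ K01))
  K-separates 2 _ = proj₁ (proj₂ (proj₂ K23))
  K-separates 3 _ = proj₂ (proj₂ (proj₂ K23))
  K-separates 4 _ = proj₁ (proj₂ (proj₂ K4))
  K-separates (suc (suc (suc (suc (suc _))))) (s≤s (s≤s (s≤s (s≤s (s≤s ())))))

  K-agree : ∀ {x x'} → proj₁ K01 x ≡ proj₁ K01 x' → proj₁ K23 x ≡ proj₁ K23 x' → proj₁ K4 x ≡ proj₁ K4 x' →
    ∀ i → K i x ≡ K i x'
  K-agree e01 e23 e4 0 = e01
  K-agree e01 e23 e4 1 = e01
  K-agree e01 e23 e4 2 = e23
  K-agree e01 e23 e4 3 = e23
  K-agree e01 e23 e4 (suc (suc (suc (suc _)))) = e4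

  colourXY : Fin n → Fin n → ℕ
  colourXY x y = class (edge x y) + 5 * K (class (edge x y)) x

  colourXY< : ∀ {x y} → X x → T (adj G x y) → colourXY x y < 5 * r
  colourXY< {x} {y} xx a = digits-bound (class< xx a) (K< (class (edge x y)) xx)

  colourXY-digits : ∀ {x y x' y'} → X x → T (adj G x y) → X x' → T (adj G x' y') →
    colourXY x y ≡ colourXY x' y' →
    class (edge x y) ≡ class (edge x' y') × K (class (edge x y)) x ≡ K (class (edge x' y')) x'
  colourXY-digits xx a xx' a' = digits-injective (class< xx a) (class< xx' a')

  colour : Fin n → Fin n → ℕ
  colour u v = if side u then colourXY u v else colourXY v u

  colour-X : ∀ {u v} → X u → colour u v ≡ colourXY u v
  colour-X xu rewrite xu = refl

  colour-Y : ∀ {u v} → side u ≡ false → colour u v ≡ colourXY v u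
  colour-Y yu rewrite yu = refl

  colour-sym : ∀ u v → T (adj G u v) → colour u v ≡ colour v u
  colour-sym u v a with X-or-Y u
  ... | inj₁ xu = trans (colour-X xu) (sym (colour-Y (X→Y xu a)))
  ... | inj₂ yu = trans (colour-Y yu) (sym (colour-X (Y→X yu a)))

  -- at an X-vertex, edges of equal colour have equal classes, hence coincide
  proper-at-X : ∀ {x u w} → X x → T (adj G x u) → T (adj G x w) → colourXY x u ≡ colourXY x w → u ≡ w
  proper-at-X xx au aw eq = class-determines-y xx au aw (proj₁ (colourXY-digits xx au xx aw eq))

  -- at a Y-vertex y, edges uy and wy of equal colour have a common class i; then
  -- y is the partner of class i of both u and w, which K i separates
  proper-at-Y : ∀ {y u w} → X u → X w → T (adj G u y) → T (adj G w y) → colourXY u y ≡ colourXY w y → u ≡ w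
  proper-at-Y {y} {u} {w} xu xw au aw eq with colourXY-digits xu au xw aw eq
  ... | same-class , same-K =
        separated-unique (K-separates i (class< xu au)) xu xw same-partner
          (trans same-K (cong (λ j → K j w) (sym same-class)))
    where
    i : ℕ
    i = class (edge u y)
    same-partner : partner i u ≡ partner i w
    same-partner = trans (sym (partner-unique xu au))
                         (trans (partner-unique xw aw) (cong (λ j → partner j w) (sym same-class)))

  colour-proper : ∀ v u w → T (adj G v u) → T (adj G v w) → u ≢ w → colour v u ≢ colour v w
  colour-proper v u w au aw u≢w eq with X-or-Y v
  ... | inj₁ xv = u≢w (proper-at-X xv au aw (trans (sym (colour-X xv)) (trans eq (colour-X xv))))
  ... | inj₂ yv = u≢w (proper-at-Y (Y→X yv au) (Y→X yv aw) (adj-sym au) (adj-sym aw)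
                        (trans (sym (colour-Y yv)) (trans eq (colour-Y yv))))

  φ : ProperEdgeColouring G
  φ = record { col = colour ; col-sym = colour-sym ; proper = colour-proper }

  -- The palette of every Y-vertex is the set of all colours below 5r: these are
  -- the only colours used, and its 5r distinct colours must exhaust them.
  palette-Y-bound : ∀ {y c} → side y ≡ false → InPalette φ y c → c < 5 * r
  palette-Y-bound yy (x , a , refl) = subst (_< 5 * r) (sym (colour-Y yy)) (colourXY< (Y→X yy a) (adj-sym a))

  palette-Y-full : ∀ {y c} → side y ≡ false → c < 5 * r → InPalette φ y c
  palette-Y-full {y} {c} yy c<5r = star-saturated y (colour y)
    (λ x a → subst (colour y x <_) (sym (degY y yy)) (subst (_< 5 * r) (sym (colour-Y yy)) (colourXY< (Y→X yy a) (adj-sym a))))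
    (λ x x' a a' → PaletteCounting.colour-injective φ a a')
    c (subst (c <_) (sym (degY y yy)) c<5r)

  -- The palette of an X-vertex x is {i + 5 · K i x : i < 5}, so it is determined by the K i x.
  palette-X : ∀ {x x' c} → X x → X x' → (∀ i → K i x ≡ K i x') → InPalette φ x c → InPalette φ x' c
  palette-X {x} {x'} xx xx' K≡ (y , a , refl) = partner i x' , proj₁ spec , (begin
      colour x' (partner i x')                    ≡⟨ colour-X xx' ⟩
      colourXY x' (partner i x')                  ≡⟨ cong (λ j → j + 5 * K j x') (proj₂ spec) ⟩
      i + 5 * K i x'                              ≡⟨ cong (λ k → i + 5 * k) (sym (K≡ i)) ⟩
      colourXY x y                                ≡⟨ sym (colour-X xx) ⟩
      colour x y                                  ∎)
    where
    open ≡-Reasoning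
    i : ℕ
    i = class (edge x y)
    spec : T (adj G x' (partner i x')) × class (edge x' (partner i x')) ≡ i
    spec = partner-spec xx' (class< xx a)

  code : Fin n → ℕ
  code v = proj₁ K01 v + r * (proj₁ K23 v + r * proj₁ K4 v)

  code< : ∀ {v} → X v → code v < r ^ 3
  code< xv = digits-bound (K< 0 xv) (digits-bound (K< 2 xv)
               (subst (proj₁ K4 _ <_) (sym (ℕ.*-identityʳ r)) (K< 4 xv)))

  label : Fin n → Fin (suc (r ^ 3))
  label v = if side v then fsuc (code v mod r ^ 3) else fzero

  label-X : ∀ {v} → X v → label v ≡ fsuc (code v mod r ^ 3)
  label-X xv rewrite xv = refl

  label-Y : ∀ {v} → side v ≡ false → label v ≡ fzero
  label-Y yv rewrite yv = refl

  same-label⇒same-code : ∀ {v w} → X v → X w → label v ≡ label w → code v ≡ code w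
  same-label⇒same-code {v} {w} xv xw eq = begin
    code v                  ≡⟨ sym (m<n⇒m%n≡m (code< xv)) ⟩
    code v % r ^ 3          ≡⟨ sym (toℕ-fromℕ< _) ⟩
    toℕ (code v mod r ^ 3)  ≡⟨ cong toℕ (suc-injective (trans (sym (label-X xv)) (trans eq (label-X xw)))) ⟩
    toℕ (code w mod r ^ 3)  ≡⟨ toℕ-fromℕ< _ ⟩
    code w % r ^ 3          ≡⟨ m<n⇒m%n≡m (code< xw) ⟩
    code w                  ∎
    where open ≡-Reasoning

  same-code : ∀ {v w} → X v → X w → label v ≡ label w → ∀ i → K i v ≡ K i w
  same-code xv xw eq with digits-injective (K< 0 xv) (K< 0 xw) (same-label⇒same-code xv xw eq)
  ... | same01 , rest with digits-injective (K< 2 xv) (K< 2 xw) rest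
  ...   | same23 , same4 = K-agree same01 same23 same4

  same-label⇒same-palette : ∀ v w → label v ≡ label w → SamePalette φ v w
  same-label⇒same-palette v w eq c with X-or-Y v | X-or-Y w
  ... | inj₁ xv | inj₁ xw = mk⇔ (palette-X xv xw (same-code xv xw eq)) (palette-X xw xv (λ i → sym (same-code xv xw eq i)))
  ... | inj₂ yv | inj₂ yw = mk⇔ (palette-Y-full yw ∘ palette-Y-bound yv) (palette-Y-full yv ∘ palette-Y-bound yw)
  ... | inj₁ xv | inj₂ yw with trans (sym (label-X xv)) (trans eq (label-Y yw))
  ...   | ()
  same-label⇒same-palette v w eq c | inj₂ yv | inj₁ xw with trans (sym (label-Y yv)) (trans eq (label-X xw))
  ...   | ()

  palette-index≤ : PaletteIndex≤ G (r ^ 3 + 1)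
  palette-index≤ = φ , subst (AtMostPalettes φ) (ℕ.+-comm 1 (r ^ 3)) (label , same-label⇒same-palette)

module LowerBound (r : ℕ) (r≥2 : 2 ≤ r) {n : ℕ} (G : Graph n) (v₀ : Fin n) (side : Fin n → Bool)
  (bipartite : ∀ u v → T (adj G u v) → side u ≢ side v)
  (degX : ∀ v → side v ≡ true → deg G v ≡ 5)
  (degY : ∀ v → side v ≡ false → deg G v ≡ 5 * r) where

  open Star G
  open Sides G side bipartite

  some-Y : Σ (Fin n) λ y → side y ≡ false
  some-Y with X-or-Y v₀
  ... | inj₂ yv₀ = v₀ , yv₀
  ... | inj₁ xv₀ = neighbour v₀ first , X→Y xv₀ (neighbour-adj v₀ first)
    where
    first : Fin (deg G v₀)
    first = subst Fin (sym (degX v₀ xv₀)) fzero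

  5<5r : 5 < 5 * r
  5<5r = ℕ.<-≤-trans (ℕ.m<m+n 5 (s≤s z≤n)) (ℕ.*-monoʳ-≤ 5 r≥2)

  palette-index≥ : PaletteIndex≥ G (r + 1)
  palette-index≥ zero    (ψ , label , _) with label (proj₁ some-Y)
  ... | ()
  palette-index≥ (suc j) (ψ , palettes) =
    subst (_≤ suc j) (ℕ.+-comm 1 r) (s≤s (ℕ.*-cancelˡ-≤ 5 5r≤5j))
    where
    y : Fin n
    y = proj₁ some-Y
    yy : side y ≡ false
    yy = proj₂ some-Y
    5r≤5j : 5 * r ≤ 5 * j
    5r≤5j = subst₂ _≤_ (degY y yy) (ℕ.*-comm j 5)
      (PaletteCounting.palettes-lower-bound ψ y (λ x a → ℕ.≤-reflexive (degX x (Y→X yy a)))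
        (subst (5 <_) (sym (degY y yy)) 5<5r) palettes)

proposition4p11 : (r : ℕ) → 2 ≤ r → {n : ℕ} → (G : Graph n) → Fin n →
    IsBiregular 5 (5 * r) G →
    PaletteIndex≥ G (r + 1) × PaletteIndex≤ G (r ^ 3 + 1)
proposition4p11 r r≥2 G v₀ (side , bipartite , degX , degY) =
  LowerBound.palette-index≥ r r≥2 G v₀ side bipartite degX degY ,
  UpperBound.palette-index≤ r (ℕ.<-≤-trans (s≤s z≤n) r≥2) G side bipartite degX degY
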